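{- Let $\lambda\in\mathbb{C}$ with $\lambda\neq1$ and $\lambda\neq-1$, let $\mu\in\mathbb{Z}_+=\{0,1,2,\dots\}$, let $n\geq1$ be an integer and $1\leq k\leq n$. Then \[ \frac{\binom{\mu n}{n-k}}{(k-1)!}=\sum_{a=0}^{n}\sum_{b=k}^{n}\sum_{l_1+\cdots+l_n=b-k}\binom{n}{a}\binom{a}{n-b}\binom{b-k}{l_1,\ldots,l_n}\binom{b-1}{k-1}\lambda^{a}\frac{1}{(b-1)!}\left(\prod_{i=1}^{n}C_{l_i}(\mu\mid\lambda)\right), \] where the innermost sum runs over all $n$-tuples $(l_1,\dots,l_n)$ of nonnegative integers with $l_1+\cdots+l_n=b-k$, and $\binom{b-k}{l_1,\ldots,l_n}$ is the multinomial coefficient.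
   Context: For $\lambda\in\mathbb{C}$ with $\lambda\neq-1$, the Changhee polynomials of the second kind $C_k(x\mid\lambda)$ are defined by the generating function $\sum_{k=0}^{\infty}C_k(x\mid\lambda)\frac{t^k}{k!}=\frac{1}{1+\lambda(1+t)}(1+t)^x$. The convention $\lambda^0=1$ is used. -}

module Defs where

open import Level using (Level; _⊔_) renaming (suc to lsuc)
open import Algebra.Bundles using (CommutativeRing)
open import Data.Nat using (ℕ; zero; suc; _∸_; _!)
import Data.Nat as ℕ
open import Data.Nat.Combinatorics using (_C_)
open import Data.List using (List; []; _∷_; map; foldr; concatMap; upTo)
open import Data.Vec using (Vec; []; _∷_)
import Data.Vec
open import Relation.Nullary using (¬_)

module RingOps {c ℓ : Level} (R : CommutativeRing c ℓ) where
  open CommutativeRing R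

  ι : ℕ → Carrier
  ι zero    = 0#
  ι (suc n) = 1# + ι n

  infixr 8 _^_
  _^_ : Carrier → ℕ → Carrier
  x ^ zero  = 1#
  x ^ suc n = x * (x ^ n)

  sumL : List Carrier → Carrier
  sumL = foldr _+_ 0#

  -- Σ_{i = lo}^{hi} f i  (empty if hi < lo)
  sumFromTo : ℕ → ℕ → (ℕ → Carrier) → Carrier
  sumFromTo lo hi f = sumL (map (λ j → f (lo ℕ.+ j)) (upTo (suc hi ∸ lo)))

  prodV : ∀ {n} → Vec Carrier n → Carrier
  prodV = Data.Vec.foldr _ _*_ 1#

-- A field of characteristic zero (ℂ is the intended instance).
-- The inverse is a total operation, specified only on nonzero elements.
record CharZeroField (c ℓ : Level) : Set (lsuc (c ⊔ ℓ)) where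
  field
    commutativeRing : CommutativeRing c ℓ
  open CommutativeRing commutativeRing
  open RingOps commutativeRing
  field
    _⁻¹      : Carrier → Carrier
    inverseʳ : ∀ x → ¬ (x ≈ 0#) → (x * x ⁻¹) ≈ 1#
    charZero : ∀ n → ¬ (ι (suc n) ≈ 0#)

module FieldOps {c ℓ : Level} (F : CharZeroField c ℓ) where
  open CharZeroField F public
  open CommutativeRing commutativeRing public
  open RingOps commutativeRing public

  -- Changhee polynomials of the second kind at x = μ ∈ ℕ.
  -- Generating function: Σ_k C_k(μ∣λ) t^k/k! = (1+t)^μ / (1 + λ(1+t)).
  -- Writing c_k = C_k(μ∣λ)/k!, comparing coefficients of t^k in
  --   ((1+λ) + λ t) · Σ_k c_k t^k = Σ_k binom(μ,k) t^k
  -- gives (1+λ) c_0 = binom(μ,0) and (1+λ) c_{k+1} + λ c_k = binom(μ,k+1).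
  changheeCoeff : Carrier → ℕ → ℕ → Carrier
  changheeCoeff lam μ zero    = ι (μ C 0) * (1# + lam) ⁻¹
  changheeCoeff lam μ (suc k) =
    (ι (μ C suc k) - lam * changheeCoeff lam μ k) * (1# + lam) ⁻¹

  Changhee : ℕ → ℕ → Carrier → Carrier
  Changhee k μ lam = ι (k !) * changheeCoeff lam μ k

  multinomial : ∀ {n} → ℕ → Vec ℕ n → Carrier
  multinomial s ls =
    ι (s !) * (ι (Data.Vec.foldr _ (λ l acc → (l !) ℕ.* acc) 1 ls)) ⁻¹

compositions : (n s : ℕ) → List (Vec ℕ n)
compositions zero zero    = [] ∷ []
compositions zero (suc s) = []
compositions (suc n) s =
  concatMap (λ l → map (l ∷_) (compositions n (s ∸ l))) (upTo (suc s))

{-# OPTIONS --safe #-}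
module Submission where

-- Let γ(t) = Σ_k C_k(μ∣λ) t^k / k! and h(t) = 1 + λ(1 + t). The generating function
-- says h·γ = (1 + t)^μ, hence h^n·γ^n = (1 + t)^{μn}. The binomial theorem gives
-- [t^i] h^n = Σ_a binom(n,a) binom(a,i) λ^a, while [t^j] γ^n is the sum over the
-- compositions l_1 + ⋯ + l_n = j of Π_i C_{l_i}(μ∣λ)/l_i! = binom(j; l) Π_i C_{l_i}(μ∣λ) / j!.
-- Comparing coefficients of t^{n-k}, with j = b - k and
-- binom(b-1,k-1) (b-k)! / (b-1)! = 1/(k-1)!, gives the identity.

open import Level using (Level)
open import Algebra.Bundles using (CommutativeSemiring; CommutativeRing)
open import Algebra.Structures.Biased using (IsCommutativeMonoidˡ; IsCommutativeSemiringˡ)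
import Algebra.Construct.Pointwise as Pointwise
open import Data.Nat using (ℕ; zero; suc; _∸_; _≤_; _!)
import Data.Nat
import Data.Nat as ℕ
import Data.Nat.Properties as ℕ
open import Data.Nat.Properties using (1≤n!; _!*_!≢0)
open import Data.Nat.Combinatorics
  using (_C_; nCk+nC[k+1]≡[n+1]C[k+1]; nCk≡n!/k![n-k]!; k![n∸k]!∣n!)
open import Data.Nat.DivMod using (m/n*n≡m)
open import Data.Fin as Fin using (toℕ)
open import Data.Vec.Functional using (Vector)
open import Data.List using (List; []; _∷_; _++_; concatMap; upTo; applyUpTo)
import Data.List
import Data.List as List
import Data.List.Properties as List
open import Data.Vec using (Vec; []; _∷_; map)
import Data.Vec as Vec
open import Function using (_∘_)
open import Relation.Nullary using (¬_)
open import Relation.Binary.Core using (Rel)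
import Relation.Binary.PropositionalEquality as ≡
open import Defs

module PowerSeries {c ℓ : Level} (R : CommutativeSemiring c ℓ) where
  open CommutativeSemiring R
  open import Algebra.Properties.Semiring.Sum semiring
    using (sum-syntax; sum⁺-syntax; sum-cong-≋)
  open import Algebra.Properties.Semiring.Mult semiring
    using (_×_; ×-homo-+; ×-congʳ)
  open import Algebra.Properties.Semiring.Exp semiring using (_^_)
  open import Algebra.Properties.CommutativeSemigroup +-commutativeSemigroup
    using () renaming (interchange to +-interchange)
  open import Relation.Binary.Reasoning.Setoid setoid

  Series : Set c
  Series = ℕ → Carrier

  infix 4 _≋_
  _≋_ : Rel Series ℓ
  f ≋ g = ∀ i → f i ≈ g i

  infixl 6 _⊕_
  infixl 7 _⊛_

  _⊕_ : Series → Series → Series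
  (f ⊕ g) i = f i + g i

  𝟘 : Series
  𝟘 _ = 0#

  constant : Carrier → Series
  constant a zero    = a
  constant a (suc _) = 0#

  𝟙 : Series
  𝟙 = constant 1#

  shift : Series → Series
  shift f zero    = 0#
  shift f (suc i) = f i

  X : Series
  X = shift 𝟙

  _⊛_ : Series → Series → Series
  (f ⊛ g) zero    = f 0 * g 0
  (f ⊛ g) (suc m) = f 0 * g (suc m) + (f ∘ suc ⊛ g) m

  ⊛-coeff : ∀ f g m → (f ⊛ g) m ≈ ∑[ i ≤ m ] (f (toℕ i) * g (m ∸ toℕ i))
  ⊛-coeff f g zero    = sym (+-identityʳ _)
  ⊛-coeff f g (suc m) = +-congˡ (⊛-coeff (f ∘ suc) g m)

  ⊛-cong : ∀ {f f′ g g′} → f ≋ f′ → g ≋ g′ → f ⊛ g ≋ f′ ⊛ g′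
  ⊛-cong f≋f′ g≋g′ zero    = *-cong (f≋f′ 0) (g≋g′ 0)
  ⊛-cong f≋f′ g≋g′ (suc m) =
    +-cong (*-cong (f≋f′ 0) (g≋g′ (suc m))) (⊛-cong (f≋f′ ∘ suc) g≋g′ m)

  ⊛-zeroˡ : ∀ g → 𝟘 ⊛ g ≋ 𝟘
  ⊛-zeroˡ g zero    = zeroˡ _
  ⊛-zeroˡ g (suc m) = trans (+-cong (zeroˡ _) (⊛-zeroˡ g m)) (+-identityʳ 0#)

  constant-⊛ : ∀ a g → constant a ⊛ g ≋ λ i → a * g i
  constant-⊛ a g zero    = refl
  constant-⊛ a g (suc m) = trans (+-congˡ (⊛-zeroˡ g m)) (+-identityʳ _)

  ⊛-identityˡ : ∀ g → 𝟙 ⊛ g ≋ g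
  ⊛-identityˡ g i = trans (constant-⊛ 1# g i) (*-identityˡ _)

  ⊛-distribʳ : ∀ h f g → (f ⊕ g) ⊛ h ≋ f ⊛ h ⊕ g ⊛ h
  ⊛-distribʳ h f g zero    = distribʳ _ _ _
  ⊛-distribʳ h f g (suc m) = begin
    (f 0 + g 0) * h (suc m) + ((f ∘ suc ⊕ g ∘ suc) ⊛ h) m
      ≈⟨ +-cong (distribʳ _ _ _) (⊛-distribʳ h (f ∘ suc) (g ∘ suc) m) ⟩
    (f 0 * h (suc m) + g 0 * h (suc m)) + ((f ∘ suc ⊛ h) m + (g ∘ suc ⊛ h) m)
      ≈⟨ +-interchange _ _ _ _ ⟩
    (f ⊛ h ⊕ g ⊛ h) (suc m) ∎

  ⊛-scaleˡ : ∀ a f g → (λ i → a * f i) ⊛ g ≋ λ i → a * (f ⊛ g) i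
  ⊛-scaleˡ a f g zero    = *-assoc _ _ _
  ⊛-scaleˡ a f g (suc m) =
    trans (+-cong (*-assoc _ _ _) (⊛-scaleˡ a (f ∘ suc) g m)) (sym (distribˡ a _ _))

  ⊛-assoc : ∀ f g h → (f ⊛ g) ⊛ h ≋ f ⊛ (g ⊛ h)
  ⊛-assoc f g h zero    = *-assoc _ _ _
  ⊛-assoc f g h (suc m) = begin
    (f 0 * g 0) * h (suc m) + (((λ i → f 0 * g (suc i)) ⊕ f ∘ suc ⊛ g) ⊛ h) m
      ≈⟨ +-congˡ (⊛-distribʳ h _ _ m) ⟩
    (f 0 * g 0) * h (suc m) + (((λ i → f 0 * g (suc i)) ⊛ h) m + ((f ∘ suc ⊛ g) ⊛ h) m)
      ≈⟨ +-congˡ (+-cong (⊛-scaleˡ (f 0) (g ∘ suc) h m) (⊛-assoc (f ∘ suc) g h m)) ⟩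
    (f 0 * g 0) * h (suc m) + (f 0 * (g ∘ suc ⊛ h) m + (f ∘ suc ⊛ (g ⊛ h)) m)
      ≈⟨ +-assoc _ _ _ ⟨
    ((f 0 * g 0) * h (suc m) + f 0 * (g ∘ suc ⊛ h) m) + (f ∘ suc ⊛ (g ⊛ h)) m
      ≈⟨ +-congʳ (trans (+-congʳ (*-assoc _ _ _)) (sym (distribˡ _ _ _))) ⟩
    (f ⊛ (g ⊛ h)) (suc m) ∎

  ⊛-unfoldʳ : ∀ f g m → (f ⊛ g) (suc m) ≈ (f ⊛ g ∘ suc) m + f (suc m) * g 0
  ⊛-unfoldʳ f g zero    = refl
  ⊛-unfoldʳ f g (suc m) =
    trans (+-congˡ (⊛-unfoldʳ (f ∘ suc) g m)) (sym (+-assoc _ _ _))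

  ⊛-comm : ∀ f g → f ⊛ g ≋ g ⊛ f
  ⊛-comm f g zero    = *-comm _ _
  ⊛-comm f g (suc m) = begin
    f 0 * g (suc m) + (f ∘ suc ⊛ g) m ≈⟨ +-congˡ (⊛-comm (f ∘ suc) g m) ⟩
    f 0 * g (suc m) + (g ⊛ f ∘ suc) m ≈⟨ +-comm _ _ ⟩
    (g ⊛ f ∘ suc) m + f 0 * g (suc m) ≈⟨ +-congˡ (*-comm _ _) ⟩
    (g ⊛ f ∘ suc) m + g (suc m) * f 0 ≈⟨ ⊛-unfoldʳ g f m ⟨
    (g ⊛ f) (suc m)                   ∎

  seriesSemiring : CommutativeSemiring c ℓ
  seriesSemiring = record
    { Carrier               = Series
    ; _≈_                   = _≋_
    ; _+_                   = _⊕_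
    ; _*_                   = _⊛_
    ; 0#                    = 𝟘
    ; 1#                    = 𝟙
    ; isCommutativeSemiring = IsCommutativeSemiringˡ.isCommutativeSemiring record
      { +-isCommutativeMonoid = Pointwise.isCommutativeMonoid ℕ +-isCommutativeMonoid
      ; *-isCommutativeMonoid = IsCommutativeMonoidˡ.isCommutativeMonoid record
        { isSemigroup = record
          { isMagma = record
            { isEquivalence = Pointwise.isEquivalence ℕ isEquivalence
            ; ∙-cong        = ⊛-cong
            }
          ; assoc   = ⊛-assoc
          }
        ; identityˡ   = ⊛-identityˡ
        ; comm        = ⊛-comm
        }
      ; distribʳ              = ⊛-distribʳ
      ; zeroˡ                 = ⊛-zeroˡ
      }
    }

  open import Algebra.Properties.CommutativeSemiring.Exp seriesSemiring
    using (^-distrib-*) renaming (_^_ to _^ₛ_)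
  open import Algebra.Properties.CommutativeSemiring.Binomial seriesSemiring
    using (binomialExpansion) renaming (theorem to binomialTheorem)
  open import Algebra.Properties.Semiring.Sum (CommutativeSemiring.semiring seriesSemiring)
    using () renaming (sum to sumₛ)
  open import Algebra.Properties.Semiring.Mult (CommutativeSemiring.semiring seriesSemiring)
    using () renaming (_×_ to _×ₛ_)

  sumₛ-coeff : ∀ {n} (F : Vector Series n) j → sumₛ F j ≈ ∑[ k < n ] F k j
  sumₛ-coeff {zero}  F j = refl
  sumₛ-coeff {suc n} F j = +-congˡ (sumₛ-coeff (F ∘ Fin.suc) j)

  ×ₛ-coeff : ∀ n f j → (n ×ₛ f) j ≈ n × f j
  ×ₛ-coeff zero    f j = refl
  ×ₛ-coeff (suc n) f j = +-congˡ (×ₛ-coeff n f j)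

  shift-cong : ∀ {f g} → f ≋ g → shift f ≋ shift g
  shift-cong f≋g zero    = refl
  shift-cong f≋g (suc i) = f≋g i

  shift-⊛ : ∀ f g → shift f ⊛ g ≋ shift (f ⊛ g)
  shift-⊛ f g zero    = zeroˡ _
  shift-⊛ f g (suc m) = trans (+-congʳ (zeroˡ _)) (+-identityˡ _)

  [𝟙⊕X]⊛ : ∀ g → (𝟙 ⊕ X) ⊛ g ≋ g ⊕ shift g
  [𝟙⊕X]⊛ g i = trans (⊛-distribʳ g 𝟙 X i)
    (+-cong (⊛-identityˡ g i) (trans (shift-⊛ 𝟙 g i) (shift-cong (⊛-identityˡ g) i)))

  [𝟙⊕X]^-coeff : ∀ a j → ((𝟙 ⊕ X) ^ₛ a) j ≈ (a C j) × 1#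
  [𝟙⊕X]^-coeff zero    zero    = sym (+-identityʳ 1#)
  [𝟙⊕X]^-coeff zero    (suc j) = refl
  [𝟙⊕X]^-coeff (suc a) zero    =
    trans ([𝟙⊕X]⊛ ((𝟙 ⊕ X) ^ₛ a) 0) (trans (+-identityʳ _) ([𝟙⊕X]^-coeff a 0))
  [𝟙⊕X]^-coeff (suc a) (suc j) = begin
    ((𝟙 ⊕ X) ⊛ (𝟙 ⊕ X) ^ₛ a) (suc j)
      ≈⟨ [𝟙⊕X]⊛ ((𝟙 ⊕ X) ^ₛ a) (suc j) ⟩
    ((𝟙 ⊕ X) ^ₛ a) (suc j) + ((𝟙 ⊕ X) ^ₛ a) j
      ≈⟨ +-cong ([𝟙⊕X]^-coeff a (suc j)) ([𝟙⊕X]^-coeff a j) ⟩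
    (a C suc j) × 1# + (a C j) × 1#
      ≈⟨ +-comm _ _ ⟩
    (a C j) × 1# + (a C suc j) × 1#
      ≈⟨ ×-homo-+ 1# (a C j) (a C suc j) ⟨
    (a C j ℕ.+ a C suc j) × 1#
      ≡⟨ ≡.cong (_× 1#) (nCk+nC[k+1]≡[n+1]C[k+1] a j) ⟩
    (suc a C suc j) × 1# ∎

  constant-^ : ∀ a k → constant a ^ₛ k ≋ constant (a ^ k)
  constant-^ a zero    i       = refl
  constant-^ a (suc k) zero    = *-congˡ (constant-^ a k 0)
  constant-^ a (suc k) (suc i) =
    trans (constant-⊛ a _ (suc i)) (trans (*-congˡ (constant-^ a k (suc i))) (zeroʳ a))

  𝟙-^ : ∀ n → 𝟙 ^ₛ n ≋ 𝟙
  𝟙-^ zero    i = refl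
  𝟙-^ (suc n) i = trans (⊛-identityˡ _ i) (𝟙-^ n i)

  [a[𝟙⊕X]]^-coeff : ∀ a k j → ((constant a ⊛ (𝟙 ⊕ X)) ^ₛ k) j ≈ a ^ k * (k C j) × 1#
  [a[𝟙⊕X]]^-coeff a k j = begin
    ((constant a ⊛ (𝟙 ⊕ X)) ^ₛ k) j      ≈⟨ ^-distrib-* (constant a) (𝟙 ⊕ X) k j ⟩
    (constant a ^ₛ k ⊛ (𝟙 ⊕ X) ^ₛ k) j   ≈⟨ ⊛-cong (constant-^ a k) (λ _ → refl) j ⟩
    (constant (a ^ k) ⊛ (𝟙 ⊕ X) ^ₛ k) j  ≈⟨ constant-⊛ (a ^ k) _ j ⟩
    a ^ k * ((𝟙 ⊕ X) ^ₛ k) j             ≈⟨ *-congˡ ([𝟙⊕X]^-coeff k j) ⟩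
    a ^ k * (k C j) × 1#                 ∎

  [a[𝟙⊕X]⊕𝟙]^-coeff : ∀ a n j → ((constant a ⊛ (𝟙 ⊕ X) ⊕ 𝟙) ^ₛ n) j
    ≈ ∑[ k ≤ n ] ((n C toℕ k) × (a ^ toℕ k * (toℕ k C j) × 1#))
  [a[𝟙⊕X]⊕𝟙]^-coeff a n j = begin
    ((x ⊕ 𝟙) ^ₛ n) j                                       ≈⟨ binomialTheorem n x 𝟙 j ⟩
    binomialExpansion x 𝟙 n j                              ≈⟨ sumₛ-coeff {suc n} term j ⟩
    ∑[ k ≤ n ] term k j                                    ≈⟨ sum-cong-≋ {suc n} term-coeff ⟩
    ∑[ k ≤ n ] ((n C toℕ k) × (a ^ toℕ k * (toℕ k C j) × 1#)) ∎
    where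
    x = constant a ⊛ (𝟙 ⊕ X)
    term : Vector Series (suc n)
    term k = (n C toℕ k) ×ₛ (x ^ₛ toℕ k ⊛ 𝟙 ^ₛ (n ∸ toℕ k))
    term-coeff : ∀ k → term k j ≈ (n C toℕ k) × (a ^ toℕ k * (toℕ k C j) × 1#)
    term-coeff k = trans (×ₛ-coeff (n C toℕ k) _ j) (×-congʳ (n C toℕ k) (begin
      (x ^ₛ toℕ k ⊛ 𝟙 ^ₛ (n ∸ toℕ k)) j ≈⟨ ⊛-cong (λ _ → refl) (𝟙-^ (n ∸ toℕ k)) j ⟩
      (x ^ₛ toℕ k ⊛ 𝟙) j                ≈⟨ ⊛-comm _ 𝟙 j ⟩
      (𝟙 ⊛ x ^ₛ toℕ k) j                ≈⟨ ⊛-identityˡ _ j ⟩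
      (x ^ₛ toℕ k) j                    ≈⟨ [a[𝟙⊕X]]^-coeff a (toℕ k) j ⟩
      a ^ toℕ k * (toℕ k C j) × 1#      ∎))

  [a[𝟙⊕X]⊕𝟙]⊛-coeff : ∀ a g i →
    ((constant a ⊛ (𝟙 ⊕ X) ⊕ 𝟙) ⊛ g) i ≈ a * (g i + shift g i) + g i
  [a[𝟙⊕X]⊕𝟙]⊛-coeff a g i = begin
    ((constant a ⊛ (𝟙 ⊕ X) ⊕ 𝟙) ⊛ g) i
      ≈⟨ ⊛-distribʳ g (constant a ⊛ (𝟙 ⊕ X)) 𝟙 i ⟩
    ((constant a ⊛ (𝟙 ⊕ X)) ⊛ g) i + (𝟙 ⊛ g) i
      ≈⟨ +-cong (⊛-assoc (constant a) (𝟙 ⊕ X) g i) (⊛-identityˡ g i) ⟩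
    (constant a ⊛ ((𝟙 ⊕ X) ⊛ g)) i + g i
      ≈⟨ +-congʳ (constant-⊛ a _ i) ⟩
    a * ((𝟙 ⊕ X) ⊛ g) i + g i
      ≈⟨ +-congʳ (*-congˡ ([𝟙⊕X]⊛ g i)) ⟩
    a * (g i + shift g i) + g i ∎

module RingOpsProperties {c ℓ : Level} (R : CommutativeRing c ℓ) where
  open CommutativeRing R
  open RingOps R
  open PowerSeries commutativeSemiring
  open import Algebra.Properties.Semiring.Sum semiring using (sum-syntax; sum⁺-syntax)
  open import Algebra.Properties.Semiring.Mult semiring using (_×_; ×-congʳ; ×-assoc-*)
  import Algebra.Properties.Semiring.Exp semiring as Exp
  open import Algebra.Properties.CommutativeSemiring.Exp seriesSemiring
    using () renaming (_^_ to _^ₛ_)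
  open import Relation.Binary.Reasoning.Setoid setoid

  ι≡×1# : ∀ n → ι n ≡.≡ n × 1#
  ι≡×1# zero    = ≡.refl
  ι≡×1# (suc n) = ≡.cong (1# +_) (ι≡×1# n)

  ×≈ι* : ∀ n x → n × x ≈ ι n * x
  ×≈ι* n x = begin
    n × x         ≈⟨ ×-congʳ n (*-identityˡ x) ⟨
    n × (1# * x)  ≈⟨ ×-assoc-* n 1# x ⟨
    n × 1# * x    ≡⟨ ≡.cong (_* x) (ι≡×1# n) ⟨
    ι n * x       ∎

  ^≡^ : ∀ x n → x ^ n ≡.≡ x Exp.^ n
  ^≡^ x zero    = ≡.refl
  ^≡^ x (suc n) = ≡.cong (x *_) (^≡^ x n)

  sumL-++ : ∀ xs ys → sumL (xs ++ ys) ≈ sumL xs + sumL ys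
  sumL-++ []       ys = sym (+-identityˡ _)
  sumL-++ (x ∷ xs) ys = trans (+-congˡ (sumL-++ xs ys)) (sym (+-assoc _ _ _))

  sumL-cong : ∀ {A : Set} {f g : A → Carrier} xs →
    (∀ x → f x ≈ g x) → sumL (List.map f xs) ≈ sumL (List.map g xs)
  sumL-cong []       f≈g = refl
  sumL-cong (x ∷ xs) f≈g = +-cong (f≈g x) (sumL-cong xs f≈g)

  sumL-distribˡ : ∀ {A : Set} a (f : A → Carrier) xs →
    sumL (List.map (λ x → a * f x) xs) ≈ a * sumL (List.map f xs)
  sumL-distribˡ a f []       = sym (zeroʳ a)
  sumL-distribˡ a f (x ∷ xs) = trans (+-congˡ (sumL-distribˡ a f xs)) (sym (distribˡ a _ _))

  sumL-concatMap : ∀ {A B : Set} (f : B → Carrier) (G : A → List B) xs →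
    sumL (List.map f (concatMap G xs)) ≈ sumL (List.map (λ x → sumL (List.map f (G x))) xs)
  sumL-concatMap f G []       = refl
  sumL-concatMap f G (x ∷ xs) = begin
    sumL (List.map f (G x ++ concatMap G xs))
      ≡⟨ ≡.cong sumL (List.map-++ f (G x) (concatMap G xs)) ⟩
    sumL (List.map f (G x) ++ List.map f (concatMap G xs))
      ≈⟨ sumL-++ (List.map f (G x)) _ ⟩
    sumL (List.map f (G x)) + sumL (List.map f (concatMap G xs))
      ≈⟨ +-congˡ (sumL-concatMap f G xs) ⟩
    sumL (List.map (λ x → sumL (List.map f (G x))) (x ∷ xs)) ∎

  sumL-applyUpTo : ∀ (f : ℕ → Carrier) n → sumL (applyUpTo f n) ≡.≡ ∑[ i < n ] f (toℕ i)
  sumL-applyUpTo f zero    = ≡.refl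
  sumL-applyUpTo f (suc n) = ≡.cong (f 0 +_) (sumL-applyUpTo (f ∘ suc) n)

  sumL-upTo : ∀ (f : ℕ → Carrier) n → sumL (List.map f (upTo n)) ≡.≡ ∑[ i < n ] f (toℕ i)
  sumL-upTo f n = ≡.trans (≡.cong sumL (List.map-upTo f n)) (sumL-applyUpTo f n)

  sumFromTo≡∑ : ∀ lo hi f → sumFromTo lo hi f ≡.≡ ∑[ j < suc hi ∸ lo ] f (lo ℕ.+ toℕ j)
  sumFromTo≡∑ lo hi f = sumL-upTo (λ j → f (lo ℕ.+ j)) (suc hi ∸ lo)

  sumL-compositions : ∀ (f : Series) n s →
    sumL (List.map (λ ls → prodV (map f ls)) (compositions n s)) ≈ (f ^ₛ n) s
  sumL-compositions f zero    zero    = +-identityʳ 1#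
  sumL-compositions f zero    (suc s) = refl
  sumL-compositions f (suc n) s = begin
    sumL (List.map Π (concatMap G (upTo (suc s))))
      ≈⟨ sumL-concatMap Π G (upTo (suc s)) ⟩
    sumL (List.map (λ l → sumL (List.map Π (G l))) (upTo (suc s)))
      ≈⟨ sumL-cong (upTo (suc s)) sumL-G ⟩
    sumL (List.map (λ l → f l * (f ^ₛ n) (s ∸ l)) (upTo (suc s)))
      ≡⟨ sumL-upTo (λ l → f l * (f ^ₛ n) (s ∸ l)) (suc s) ⟩
    ∑[ i ≤ s ] (f (toℕ i) * (f ^ₛ n) (s ∸ toℕ i))
      ≈⟨ ⊛-coeff f (f ^ₛ n) s ⟨
    (f ^ₛ suc n) s ∎
    where
    Π : ∀ {m} → Vec ℕ m → Carrier
    Π ls = prodV (map f ls)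
    G : ℕ → List (Vec ℕ (suc n))
    G l = List.map (l ∷_) (compositions n (s ∸ l))
    sumL-G : ∀ l → sumL (List.map Π (G l)) ≈ f l * (f ^ₛ n) (s ∸ l)
    sumL-G l = begin
      sumL (List.map Π (List.map (l ∷_) (compositions n (s ∸ l))))
        ≡⟨ ≡.cong sumL (List.map-∘ (compositions n (s ∸ l))) ⟨
      sumL (List.map (λ ls → f l * Π ls) (compositions n (s ∸ l)))
        ≈⟨ sumL-distribˡ (f l) Π (compositions n (s ∸ l)) ⟩
      f l * sumL (List.map Π (compositions n (s ∸ l)))
        ≈⟨ *-congˡ (sumL-compositions f n (s ∸ l)) ⟩
      f l * (f ^ₛ n) (s ∸ l) ∎

module Changhee {c ℓ : Level} (F : CharZeroField c ℓ) where
  open FieldOps F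
  open PowerSeries commutativeSemiring
  open RingOpsProperties commutativeRing
  open import Algebra.Properties.Semiring.Sum semiring
    using (sum-syntax; sum⁺-syntax; sum-cong-≋; ∑-comm; *-distribˡ-sum; *-distribʳ-sum)
  open import Algebra.Properties.Semiring.Mult semiring using (_×_; ×1-homo-*)
  import Algebra.Properties.Semiring.Exp semiring as Exp
  open import Algebra.Properties.CommutativeSemiring.Exp seriesSemiring
    using (^-distrib-*; ^-congˡ; ^-assocʳ) renaming (_^_ to _^ₛ_)
  open import Algebra.Properties.Group +-group using (inverseʳ-unique)
  open import Algebra.Properties.CommutativeSemigroup *-commutativeSemigroup
    using (x∙yz≈y∙xz; x∙yz≈xz∙y) renaming (interchange to *-interchange)
  open import Algebra.Solver.Ring.NaturalCoefficients.Default commutativeSemiring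
    using (solve; _:+_; _:*_; _:=_; con)
  open import Relation.Binary.Reasoning.Setoid setoid

  ⁻¹-unique : ∀ x y → ¬ y ≈ 0# → x * y ≈ 1# → x ≈ y ⁻¹
  ⁻¹-unique x y y≉0 xy≈1 = begin
    x               ≈⟨ *-identityʳ x ⟨
    x * 1#          ≈⟨ *-congˡ (inverseʳ y y≉0) ⟨
    x * (y * y ⁻¹)  ≈⟨ *-assoc _ _ _ ⟨
    (x * y) * y ⁻¹  ≈⟨ *-congʳ xy≈1 ⟩
    1# * y ⁻¹       ≈⟨ *-identityˡ _ ⟩
    y ⁻¹            ∎

  ι-nonzero : ∀ {p} → 1 ≤ p → ¬ ι p ≈ 0#
  ι-nonzero {suc p} _ = charZero p

  ι-homo-* : ∀ m n → ι (m ℕ.* n) ≈ ι m * ι n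
  ι-homo-* m n = begin
    ι (m ℕ.* n)          ≡⟨ ι≡×1# (m ℕ.* n) ⟩
    (m ℕ.* n) × 1#       ≈⟨ ×1-homo-* m n ⟩
    (m × 1#) * (n × 1#)  ≡⟨ ≡.cong₂ _*_ (ι≡×1# m) (ι≡×1# n) ⟨
    ι m * ι n            ∎

  nCk*k!*[n∸k]!≡n! : ∀ {n k} → k ≤ n → (n C k) ℕ.* (k ! ℕ.* (n ∸ k) !) ≡.≡ n !
  nCk*k!*[n∸k]!≡n! {n} {k} k≤n = ≡.trans
    (≡.cong (ℕ._* (k ! ℕ.* (n ∸ k) !)) (nCk≡n!/k![n-k]! k≤n))
    (m/n*n≡m {{k !* (n ∸ k) !≢0}} (k![n∸k]!∣n! k≤n))

  nCk*[n∸k]!/n!≈1/k! : ∀ {n k} → k ≤ n →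
    ι (n C k) * ι (n !) ⁻¹ * ι ((n ∸ k) !) ≈ ι (k !) ⁻¹
  nCk*[n∸k]!/n!≈1/k! {n} {k} k≤n = ⁻¹-unique _ (ι (k !)) (ι-nonzero (1≤n! k)) (begin
    ι (n C k) * ι (n !) ⁻¹ * ι ((n ∸ k) !) * ι (k !)
      ≈⟨ regroup _ _ _ _ ⟩
    ι (n C k) * (ι (k !) * ι ((n ∸ k) !)) * ι (n !) ⁻¹
      ≈⟨ *-congʳ (trans (ι-homo-* (n C k) _) (*-congˡ (ι-homo-* (k !) ((n ∸ k) !)))) ⟨
    ι ((n C k) ℕ.* (k ! ℕ.* (n ∸ k) !)) * ι (n !) ⁻¹
      ≡⟨ ≡.cong (λ z → ι z * ι (n !) ⁻¹) (nCk*k!*[n∸k]!≡n! k≤n) ⟩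
    ι (n !) * ι (n !) ⁻¹
      ≈⟨ inverseʳ _ (ι-nonzero (1≤n! n)) ⟩
    1# ∎)
    where
    regroup : ∀ a b c d → a * b * c * d ≈ a * (d * c) * b
    regroup = solve 4 (λ a b c d → a :* b :* c :* d := a :* (d :* c) :* b) refl

  factorialProduct : ∀ {n} → Vec ℕ n → ℕ
  factorialProduct = Vec.foldr _ (λ l acc → l ! ℕ.* acc) 1

  1≤factorialProduct : ∀ {n} (ls : Vec ℕ n) → 1 ≤ factorialProduct ls
  1≤factorialProduct []       = ℕ.≤-refl
  1≤factorialProduct (l ∷ ls) = ℕ.*-mono-≤ (1≤n! l) (1≤factorialProduct ls)

  module _ (lam : Carrier) (lam≉-1 : ¬ lam ≈ - 1#) (μ : ℕ) where

    γ : Series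
    γ = changheeCoeff lam μ

    h : Series
    h = constant lam ⊛ (𝟙 ⊕ X) ⊕ 𝟙

    1+lam≉0 : ¬ 1# + lam ≈ 0#
    1+lam≉0 1+lam≈0 = lam≉-1 (inverseʳ-unique 1# lam 1+lam≈0)

    [1+lam]*-cancel : ∀ x → (1# + lam) * (x * (1# + lam) ⁻¹) ≈ x
    [1+lam]*-cancel x = begin
      (1# + lam) * (x * (1# + lam) ⁻¹)  ≈⟨ x∙yz≈y∙xz _ _ _ ⟩
      x * ((1# + lam) * (1# + lam) ⁻¹)  ≈⟨ *-congˡ (inverseʳ _ 1+lam≉0) ⟩
      x * 1#                            ≈⟨ *-identityʳ x ⟩
      x                                 ∎

    γ-recurrence : ∀ i → (1# + lam) * γ i + lam * shift γ i ≈ ι (μ C i)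
    γ-recurrence zero    = trans (+-cong ([1+lam]*-cancel _) (zeroʳ lam)) (+-identityʳ _)
    γ-recurrence (suc i) = begin
      (1# + lam) * γ (suc i) + lam * γ i           ≈⟨ +-congʳ ([1+lam]*-cancel _) ⟩
      (ι (μ C suc i) - lam * γ i) + lam * γ i      ≈⟨ +-assoc _ _ _ ⟩
      ι (μ C suc i) + (- (lam * γ i) + lam * γ i)  ≈⟨ +-congˡ (-‿inverseˡ _) ⟩
      ι (μ C suc i) + 0#                           ≈⟨ +-identityʳ _ ⟩
      ι (μ C suc i)                                ∎

    h⊛γ : h ⊛ γ ≋ (𝟙 ⊕ X) ^ₛ μ
    h⊛γ i = begin
      (h ⊛ γ) i                           ≈⟨ [a[𝟙⊕X]⊕𝟙]⊛-coeff lam γ i ⟩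
      lam * (γ i + shift γ i) + γ i       ≈⟨ regroup lam (γ i) (shift γ i) ⟩
      (1# + lam) * γ i + lam * shift γ i  ≈⟨ γ-recurrence i ⟩
      ι (μ C i)                           ≡⟨ ι≡×1# (μ C i) ⟩
      (μ C i) × 1#                        ≈⟨ [𝟙⊕X]^-coeff μ i ⟨
      ((𝟙 ⊕ X) ^ₛ μ) i                    ∎
      where
      regroup : ∀ l x y → l * (x + y) + x ≈ (1# + l) * x + l * y
      regroup = solve 3 (λ l x y → l :* (x :+ y) :+ x := (con 1 :+ l) :* x :+ l :* y) refl

    h^n⊛γ^n : ∀ n → h ^ₛ n ⊛ γ ^ₛ n ≋ (𝟙 ⊕ X) ^ₛ (μ ℕ.* n)
    h^n⊛γ^n n i =
      trans (sym (^-distrib-* h γ n i)) (trans (^-congˡ n h⊛γ i) (^-assocʳ (𝟙 ⊕ X) μ n i))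

    expansionTerm : ℕ → ℕ → ℕ → Carrier
    expansionTerm n a j = ι (n C a) * ι (a C j) * lam ^ a

    h^n-coeff : ∀ n j → (h ^ₛ n) j ≈ ∑[ a ≤ n ] expansionTerm n (toℕ a) j
    h^n-coeff n j =
      trans ([a[𝟙⊕X]⊕𝟙]^-coeff lam n j) (sum-cong-≋ {suc n} (λ a → term (toℕ a)))
      where
      term : ∀ a → (n C a) × (lam Exp.^ a * (a C j) × 1#) ≈ expansionTerm n a j
      term a = begin
        (n C a) × (lam Exp.^ a * (a C j) × 1#)  ≈⟨ ×≈ι* (n C a) _ ⟩
        ι (n C a) * (lam Exp.^ a * (a C j) × 1#)
          ≡⟨ ≡.cong₂ (λ u v → ι (n C a) * (u * v)) (^≡^ lam a) (ι≡×1# (a C j)) ⟨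
        ι (n C a) * (lam ^ a * ι (a C j))       ≈⟨ x∙yz≈xz∙y _ _ _ ⟩
        expansionTerm n a j                     ∎

    h^n⊛γ^n-coeff : ∀ n m →
      ∑[ j ≤ m ] ∑[ a ≤ n ] (expansionTerm n (toℕ a) (m ∸ toℕ j) * (γ ^ₛ n) (toℕ j))
        ≈ ι ((μ ℕ.* n) C m)
    h^n⊛γ^n-coeff n m = begin
      ∑[ j ≤ m ] ∑[ a ≤ n ] (E j a * P (toℕ j))
        ≈⟨ sum-cong-≋ {suc m} (λ j → sym (*-distribʳ-sum {suc n} (P (toℕ j)) (E j))) ⟩
      ∑[ j ≤ m ] (∑[ a ≤ n ] E j a * P (toℕ j))
        ≈⟨ sum-cong-≋ {suc m} (λ j → *-congʳ {P (toℕ j)} (sym (h^n-coeff n (m ∸ toℕ j)))) ⟩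
      ∑[ j ≤ m ] ((h ^ₛ n) (m ∸ toℕ j) * P (toℕ j))
        ≈⟨ sum-cong-≋ {suc m} (λ j → *-comm ((h ^ₛ n) (m ∸ toℕ j)) (P (toℕ j))) ⟩
      ∑[ j ≤ m ] (P (toℕ j) * (h ^ₛ n) (m ∸ toℕ j))
        ≈⟨ ⊛-coeff P (h ^ₛ n) m ⟨
      (P ⊛ h ^ₛ n) m
        ≈⟨ trans (⊛-comm P (h ^ₛ n) m) (h^n⊛γ^n n m) ⟩
      ((𝟙 ⊕ X) ^ₛ (μ ℕ.* n)) m
        ≈⟨ [𝟙⊕X]^-coeff (μ ℕ.* n) m ⟩
      ((μ ℕ.* n) C m) × 1#
        ≡⟨ ι≡×1# ((μ ℕ.* n) C m) ⟨
      ι ((μ ℕ.* n) C m) ∎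
      where
      P = γ ^ₛ n
      E : Fin.Fin (suc m) → Fin.Fin (suc n) → Carrier
      E j a = expansionTerm n (toℕ a) (m ∸ toℕ j)

    Changhee-product : ∀ {n} (ls : Vec ℕ n) →
      prodV (map (λ l → Changhee l μ lam) ls) ≈ ι (factorialProduct ls) * prodV (map γ ls)
    Changhee-product []       = sym (trans (*-congʳ (+-identityʳ 1#)) (*-identityˡ 1#))
    Changhee-product (l ∷ ls) = begin
      ι (l !) * γ l * prodV (map (λ l → Changhee l μ lam) ls)
        ≈⟨ *-congˡ (Changhee-product ls) ⟩
      ι (l !) * γ l * (ι (factorialProduct ls) * prodV (map γ ls))
        ≈⟨ *-interchange _ _ _ _ ⟩
      ι (l !) * ι (factorialProduct ls) * (γ l * prodV (map γ ls))
        ≈⟨ *-congʳ (ι-homo-* (l !) (factorialProduct ls)) ⟨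
      ι (factorialProduct (l ∷ ls)) * prodV (map γ (l ∷ ls)) ∎

    multinomial*Changhee-product : ∀ {n} s (ls : Vec ℕ n) →
      multinomial s ls * prodV (map (λ l → Changhee l μ lam) ls) ≈ ι (s !) * prodV (map γ ls)
    multinomial*Changhee-product s ls = begin
      ι (s !) * D ⁻¹ * prodV (map (λ l → Changhee l μ lam) ls)  ≈⟨ *-congˡ (Changhee-product ls) ⟩
      ι (s !) * D ⁻¹ * (D * Π)                                  ≈⟨ regroup _ _ _ _ ⟩
      ι (s !) * (D * D ⁻¹ * Π)                                  ≈⟨ *-congˡ (*-congʳ (inverseʳ D D≉0)) ⟩
      ι (s !) * (1# * Π)                                        ≈⟨ *-congˡ (*-identityˡ Π) ⟩
      ι (s !) * Π                                               ∎
      where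
      D = ι (factorialProduct ls)
      Π = prodV (map γ ls)
      D≉0 = ι-nonzero (1≤factorialProduct ls)
      regroup : ∀ a b c d → a * b * (c * d) ≈ a * (c * b * d)
      regroup = solve 4 (λ a b c d → a :* b :* (c :* d) := a :* (c :* b :* d)) refl

    summand : (n k a b : ℕ) → Vec ℕ n → Carrier
    summand n k a b ls =
      ι (n C a) * ι (a C (n ∸ b)) * multinomial (b ∸ k) ls
        * ι ((b ∸ 1) C (k ∸ 1)) * lam ^ a * ι ((b ∸ 1) !) ⁻¹
        * prodV (map (λ l → Changhee l μ lam) ls)

    summand≈ : ∀ n a k′ j (ls : Vec ℕ n) → summand n (suc k′) a (suc (k′ ℕ.+ j)) ls
      ≈ ι (k′ !) ⁻¹ * (expansionTerm n a (n ∸ suc (k′ ℕ.+ j)) * prodV (map γ ls))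
    summand≈ n a k′ j ls = begin
      summand n (suc k′) a (suc b) ls
        ≈⟨ regroup _ _ _ _ _ _ _ ⟩
      E * ((ι (b C k′) * ι (b !) ⁻¹) * (multinomial (b ∸ k′) ls * prodV (map (λ l → Changhee l μ lam) ls)))
        ≈⟨ *-congˡ (*-congˡ (multinomial*Changhee-product (b ∸ k′) ls)) ⟩
      E * ((ι (b C k′) * ι (b !) ⁻¹) * (ι ((b ∸ k′) !) * Π))
        ≈⟨ *-congˡ (*-assoc _ _ _) ⟨
      E * ((ι (b C k′) * ι (b !) ⁻¹ * ι ((b ∸ k′) !)) * Π)
        ≈⟨ *-congˡ (*-congʳ (nCk*[n∸k]!/n!≈1/k! (ℕ.m≤m+n k′ j))) ⟩
      E * (ι (k′ !) ⁻¹ * Π)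
        ≈⟨ x∙yz≈y∙xz _ _ _ ⟩
      ι (k′ !) ⁻¹ * (E * Π) ∎
      where
      b = k′ ℕ.+ j
      E = expansionTerm n a (n ∸ suc b)
      Π = prodV (map γ ls)
      regroup : ∀ x₁ x₂ x₃ x₄ x₅ x₆ x₇ →
        x₁ * x₂ * x₃ * x₄ * x₅ * x₆ * x₇ ≈ x₁ * x₂ * x₅ * ((x₄ * x₆) * (x₃ * x₇))
      regroup = solve 7 (λ x₁ x₂ x₃ x₄ x₅ x₆ x₇ →
        x₁ :* x₂ :* x₃ :* x₄ :* x₅ :* x₆ :* x₇ := x₁ :* x₂ :* x₅ :* ((x₄ :* x₆) :* (x₃ :* x₇))) refl

    sumL-summand : ∀ n a k′ j →
      sumL (List.map (summand n (suc k′) a (suc (k′ ℕ.+ j))) (compositions n (k′ ℕ.+ j ∸ k′)))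
        ≈ ι (k′ !) ⁻¹ * (expansionTerm n a (n ∸ suc k′ ∸ j) * (γ ^ₛ n) j)
    sumL-summand n a k′ j = begin
      sumL (List.map (summand n (suc k′) a (suc b)) Ls)
        ≈⟨ sumL-cong Ls (summand≈ n a k′ j) ⟩
      sumL (List.map (λ ls → W * (E * Π ls)) Ls)
        ≈⟨ trans (sumL-distribˡ W _ Ls) (*-congˡ (sumL-distribˡ E Π Ls)) ⟩
      W * (E * sumL (List.map Π Ls))
        ≈⟨ *-congˡ (*-congˡ (sumL-compositions γ n (b ∸ k′))) ⟩
      W * (E * (γ ^ₛ n) (b ∸ k′))
        ≡⟨ ≡.cong₂ (λ u v → W * (expansionTerm n a u * (γ ^ₛ n) v))
                   (ℕ.∸-+-assoc n (suc k′) j) (≡.sym (ℕ.m+n∸m≡n k′ j)) ⟨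
      W * (expansionTerm n a (n ∸ suc k′ ∸ j) * (γ ^ₛ n) j) ∎
      where
      b = k′ ℕ.+ j
      Ls = compositions n (b ∸ k′)
      W = ι (k′ !) ⁻¹
      E = expansionTerm n a (n ∸ suc b)
      Π : Vec ℕ n → Carrier
      Π ls = prodV (map γ ls)

    changhee-identity : ∀ n k′ → suc k′ ≤ n →
      sumFromTo 0 n (λ a → sumFromTo (suc k′) n (λ b →
        sumL (List.map (summand n (suc k′) a b) (compositions n (b ∸ suc k′)))))
        ≈ ι ((μ ℕ.* n) C (n ∸ suc k′)) * ι (k′ !) ⁻¹
    changhee-identity n k′ k≤n = begin
      sumFromTo 0 n (λ a → sumFromTo (suc k′) n (S a))
        ≡⟨ sumFromTo≡∑ 0 n _ ⟩
      ∑[ a ≤ n ] sumFromTo (suc k′) n (S (toℕ a))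
        ≈⟨ sum-cong-≋ {suc n} (λ a → inner (toℕ a)) ⟩
      ∑[ a ≤ n ] (W * ∑[ j ≤ m ] T (toℕ a) (toℕ j))
        ≈⟨ *-distribˡ-sum {suc n} W (λ a → ∑[ j ≤ m ] T (toℕ a) (toℕ j)) ⟨
      W * ∑[ a ≤ n ] ∑[ j ≤ m ] T (toℕ a) (toℕ j)
        ≈⟨ *-congˡ (∑-comm {suc n} {suc m} (λ a j → T (toℕ a) (toℕ j))) ⟩
      W * ∑[ j ≤ m ] ∑[ a ≤ n ] T (toℕ a) (toℕ j)
        ≈⟨ trans (*-congˡ (h^n⊛γ^n-coeff n m)) (*-comm _ _) ⟩
      ι ((μ ℕ.* n) C m) * W ∎
      where
      m = n ∸ suc k′
      W = ι (k′ !) ⁻¹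
      S : ℕ → ℕ → Carrier
      S a b = sumL (List.map (summand n (suc k′) a b) (compositions n (b ∸ suc k′)))
      T : ℕ → ℕ → Carrier
      T a j = expansionTerm n a (m ∸ j) * (γ ^ₛ n) j
      inner : ∀ a → sumFromTo (suc k′) n (S a) ≈ W * ∑[ j ≤ m ] T a (toℕ j)
      inner a = begin
        sumFromTo (suc k′) n (S a)
          ≡⟨ sumFromTo≡∑ (suc k′) n (S a) ⟩
        ∑[ j < suc n ∸ suc k′ ] S a (suc k′ ℕ.+ toℕ j)
          ≡⟨ ≡.cong (λ N → ∑[ j < N ] S a (suc k′ ℕ.+ toℕ j)) (ℕ.+-∸-assoc 1 k≤n) ⟩
        ∑[ j ≤ m ] S a (suc k′ ℕ.+ toℕ j)
          ≈⟨ sum-cong-≋ {suc m} (λ j → sumL-summand n a k′ (toℕ j)) ⟩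
        ∑[ j ≤ m ] (W * T a (toℕ j))
          ≈⟨ *-distribˡ-sum {suc m} W (λ j → T a (toℕ j)) ⟨
        W * ∑[ j ≤ m ] T a (toℕ j) ∎

theorem9 : ∀ {c ℓ : Level} (F : CharZeroField c ℓ) → let open FieldOps F in
    (lam : Carrier) → ¬ (lam ≈ 1#) → ¬ (lam ≈ - 1#) →
    (μ n k : ℕ) → 1 ≤ n → 1 ≤ k → k ≤ n →
    ι ((μ Data.Nat.* n) C (n ∸ k)) * (ι ((k ∸ 1) !)) ⁻¹
      ≈ sumFromTo 0 n (λ a → sumFromTo k n (λ b →
          sumL (Data.List.map (λ ls →
            ι (n C a) * ι (a C (n ∸ b)) * multinomial (b ∸ k) ls
              * ι ((b ∸ 1) C (k ∸ 1)) * lam ^ a * (ι ((b ∸ 1) !)) ⁻¹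
              * prodV (map (λ l → Changhee l μ lam) ls))
            (compositions n (b ∸ k)))))
theorem9 F lam _ lam≉-1 μ n (suc k′) _ _ k≤n =
  sym (changhee-identity lam lam≉-1 μ n k′ k≤n)
  where open FieldOps F; open Changhee F
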